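{- Let $k\in\mathbb{N}$ with $k\geq 2$, and let $p$ be a prime not dividing $k$. Let $r_p=\min\{t\in\mathbb{N}:p^t>k\}$ and $U_p=\{a\in\mathbb{Z}:\gcd(a,p)=1\}$. Then there is a function $\psi_p:U_p\to\{0,1,2\}$ such that, whenever $a,y\in U_p$ and $y\equiv ka \pmod{p^{r_p}}$, we have $\psi_p(a)\neq\psi_p(y)$. -}

module Defs where

open import Data.Nat as ℕ using (ℕ; _<_; _≤_; _^_)
open import Data.Integer using (ℤ; +_; _-_; _*_; 1ℤ)
open import Data.Integer.GCD using (gcd)
open import Data.Integer.Divisibility using (_∣_)
open import Data.Product using (Σ; _×_)
open import Relation.Binary.PropositionalEquality using (_≡_)

IsLeastExp : ℕ → ℕ → ℕ → Set
IsLeastExp p k r = (k < p ^ r) × (∀ t → k < p ^ t → r ≤ t)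

U : ℕ → Set
U p = Σ ℤ (λ a → gcd a (+ p) ≡ 1ℤ)

_≡_[mod_] : ℤ → ℤ → ℕ → Set
x ≡ y [mod m ] = (+ m) ∣ (x - y)

-- Modulo m = p ^ r, multiplication by k is injective on residues (as p ∤ k), and it fixes no
-- residue prime to p: k x ≡ x would give k ≡ 1 (mod m), impossible for 1 < k < m.  In the
-- graph with edges x — k x on residues every vertex has at most one image and one preimage, so
-- colouring residues greedily in increasing order, each avoiding the colours of its image
-- and its preimage when these are smaller, is a proper 3-colouring.  ψ_p(a) is the colour
-- of a mod p ^ r.
module Submission where

open import Defs
open import Data.Fin using (Fin; zero; suc; toℕ; fromℕ<)
open import Data.Fin.Properties using (any?; toℕ<n; toℕ-fromℕ<)
open import Data.Integer as ℤ using (ℤ; +_; _-_; _*_; ∣_∣)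
open import Data.Integer.DivMod using (_%ℕ_; _/ℕ_; a≡a%ℕn+[a/ℕn]*n; n%ℕd<d)
import Data.Integer.Divisibility.Signed as Signed
import Data.Integer.Properties as ℤₚ
open import Data.Integer.Tactic.RingSolver using (solve-∀)
open import Data.Nat as ℕ using (ℕ; zero; suc; _<_; _≤_; _^_; _<?_; NonZero; s≤s⁻¹)
open import Data.Nat.Coprimality using (Coprime; gcd≡1⇒coprime)
open import Data.Nat.Divisibility
  using (_∣_; divides; 1∣_; _∣0; ∣-refl; ∣-trans; m∣m*n; *-monoʳ-∣; *-cancelˡ-∣; n∣m⇒m%n≡0)
open import Data.Nat.DivMod using (m<n⇒m%n≡m)
open import Data.Nat.Primality using (Prime; euclidsLemma; prime⇒nonZero; ¬prime[1])
import Data.Nat.Properties as ℕₚ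
open import Data.Product using (Σ; ∃-syntax; _×_; _,_; proj₁; proj₂)
open import Data.Sum using (inj₁; inj₂)
open import Level using (0ℓ)
open import Relation.Binary.Bundles using (Setoid)
import Relation.Binary.Reasoning.Setoid as SetoidReasoning
open import Relation.Binary.Definitions using (tri<; tri≈; tri>)
open import Relation.Binary.PropositionalEquality
open import Relation.Nullary using (¬_; yes; no; contradiction)

freshColour : (i j : Fin 3) → ∃[ c ] c ≢ i × c ≢ j
freshColour zero             zero             = suc zero , (λ ()) , (λ ())
freshColour zero             (suc zero)       = suc (suc zero) , (λ ()) , (λ ())
freshColour zero             (suc (suc zero)) = suc zero , (λ ()) , (λ ())
freshColour (suc zero)       zero             = suc (suc zero) , (λ ()) , (λ ())
freshColour (suc (suc zero)) zero             = suc zero , (λ ()) , (λ ())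
freshColour (suc _)          (suc _)          = zero , (λ ()) , (λ ())

module GreedyColouring (f : ℕ → ℕ) where

  imageColour : ℕ → (ℕ → Fin 3) → Fin 3
  imageColour n c with f n <? n
  ... | yes _ = c (f n)
  ... | no  _ = zero

  preimageColour : ℕ → (ℕ → Fin 3) → Fin 3
  preimageColour n c with any? (λ (i : Fin n) → f (toℕ i) ℕ.≟ n)
  ... | yes (i , _) = c (toℕ i)
  ... | no  _       = zero

  nextColour : ℕ → (ℕ → Fin 3) → Fin 3
  nextColour n c = proj₁ (freshColour (imageColour n c) (preimageColour n c))

  nextColour-≢-image : ∀ n c → nextColour n c ≢ imageColour n c
  nextColour-≢-image n c = proj₁ (proj₂ (freshColour (imageColour n c) (preimageColour n c)))

  nextColour-≢-preimage : ∀ n c → nextColour n c ≢ preimageColour n c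
  nextColour-≢-preimage n c = proj₂ (proj₂ (freshColour (imageColour n c) (preimageColour n c)))

  imageColour-< : ∀ {n} c → f n < n → imageColour n c ≡ c (f n)
  imageColour-< {n} c fn<n with f n <? n
  ... | yes _    = refl
  ... | no  fn≮n = contradiction fn<n fn≮n

  preimageColour-unique : ∀ {n y} c → y < n → f y ≡ n →
                          (∀ {z} → z < n → f z ≡ n → z ≡ y) →
                          preimageColour n c ≡ c y
  preimageColour-unique {n} c y<n fy≡n unique with any? (λ (i : Fin n) → f (toℕ i) ℕ.≟ n)
  ... | yes (i , fi≡n) = cong c (unique (toℕ<n i) fi≡n)
  ... | no  none       = contradiction (fromℕ< y<n , trans (cong f (toℕ-fromℕ< y<n)) fy≡n) none

  colouringBelow : ℕ → ℕ → Fin 3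
  colouringBelow zero    _ = zero
  colouringBelow (suc n) z with z ℕ.≟ n
  ... | yes _ = nextColour n (colouringBelow n)
  ... | no  _ = colouringBelow n z

  colour : ℕ → Fin 3
  colour n = colouringBelow (suc n) n

  colour-unfold : ∀ n → colour n ≡ nextColour n (colouringBelow n)
  colour-unfold n with n ℕ.≟ n
  ... | yes _   = refl
  ... | no  n≢n = contradiction refl n≢n

  colouringBelow-colour : ∀ {n z} → z < n → colouringBelow n z ≡ colour z
  colouringBelow-colour {suc n} {z} z<1+n with z ℕ.≟ n
  ... | yes refl = sym (colour-unfold z)
  ... | no  z≢n  = colouringBelow-colour (ℕₚ.≤∧≢⇒< (s≤s⁻¹ z<1+n) z≢n)

  colour-≢-below : ∀ {n z} → z < n →
                   nextColour n (colouringBelow n) ≢ colouringBelow n z → colour n ≢ colour z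
  colour-≢-below {n} {z} z<n fresh eq = fresh (begin
    nextColour n (colouringBelow n) ≡⟨ colour-unfold n ⟨
    colour n                        ≡⟨ eq ⟩
    colour z                        ≡⟨ colouringBelow-colour z<n ⟨
    colouringBelow n z              ∎)
    where open ≡-Reasoning

  colour-≢-image : ∀ {n} → f n < n → colour n ≢ colour (f n)
  colour-≢-image {n} fn<n = colour-≢-below fn<n
    (subst (nextColour n c ≢_) (imageColour-< c fn<n) (nextColour-≢-image n c))
    where c = colouringBelow n

  colour-≢-preimage : ∀ {n y} → y < n → f y ≡ n → (∀ {z} → z < n → f z ≡ n → z ≡ y) →
                      colour n ≢ colour y
  colour-≢-preimage {n} y<n fy≡n unique = colour-≢-below y<n
    (subst (nextColour n c ≢_) (preimageColour-unique c y<n fy≡n unique) (nextColour-≢-preimage n c))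
    where c = colouringBelow n

  colour-proper : ∀ B → (∀ {x y} → x < B → y < B → f x ≡ f y → x ≡ y) →
             ∀ {x} → x < B → f x < B → f x ≢ x → colour x ≢ colour (f x)
  colour-proper B injective {x} x<B fx<B fx≢x with ℕₚ.<-cmp (f x) x
  ... | tri< fx<x _ _ = colour-≢-image fx<x
  ... | tri≈ _ fx≡x _ = contradiction fx≡x fx≢x
  ... | tri> _ _ x<fx = λ eq → colour-≢-preimage x<fx refl unique (sym eq)
    where
    unique : ∀ {z} → z < f x → f z ≡ f x → z ≡ x
    unique z<fx = injective (ℕₚ.<-trans z<fx fx<B) x<B

prime^∣*⇒^∣ : ∀ {p c} → Prime p → ¬ p ∣ c → ∀ r {z} → p ^ r ∣ c ℕ.* z → p ^ r ∣ z
prime^∣*⇒^∣ isPrime p∤c zero    _  = 1∣ _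
prime^∣*⇒^∣ {p} {c} isPrime p∤c (suc r) {z} d
  with euclidsLemma c z isPrime (∣-trans (m∣m*n (p ^ r)) d)
... | inj₁ p∣c              = contradiction p∣c p∤c
... | inj₂ (divides q refl) = subst (p ^ suc r ∣_) (ℕₚ.*-comm p q) (*-monoʳ-∣ p ih)
  where
  instance
    p≢0 : NonZero p
    p≢0 = prime⇒nonZero isPrime
  c[qp]≡p[cq] : c ℕ.* (q ℕ.* p) ≡ p ℕ.* (c ℕ.* q)
  c[qp]≡p[cq] = trans (sym (ℕₚ.*-assoc c q p)) (ℕₚ.*-comm (c ℕ.* q) p)
  ih : p ^ r ∣ q
  ih = prime^∣*⇒^∣ isPrime p∤c r (*-cancelˡ-∣ p (subst (p ^ suc r ∣_) c[qp]≡p[cq] d))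

1<m^n⇒m∣m^n : ∀ m n → 1 < m ^ n → m ∣ m ^ n
1<m^n⇒m∣m^n m zero    (ℕ.s≤s ())
1<m^n⇒m∣m^n m (suc n) _ = m∣m*n (m ^ n)

*-distribˡ-minus : ∀ i j k → i * (j - k) ≡ i * j - i * k
*-distribˡ-minus = solve-∀

*-cancelˡ-≡-mod-prime^ : ∀ {p c} → Prime p → ¬ p ∣ c → ∀ r {x y} →
                         (+ c * x) ≡ + c * y [mod p ^ r ] → x ≡ y [mod p ^ r ]
*-cancelˡ-≡-mod-prime^ {p} {c} isPrime p∤c r {x} {y} cx≡cy =
  prime^∣*⇒^∣ isPrime p∤c r (subst (p ^ r ∣_) ∣cx-cy∣≡c∣x-y∣ cx≡cy)
  where
  ∣cx-cy∣≡c∣x-y∣ : ∣ + c * x - + c * y ∣ ≡ c ℕ.* ∣ x - y ∣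
  ∣cx-cy∣≡c∣x-y∣ = trans (cong ∣_∣ (sym (*-distribˡ-minus (+ c) x y))) (ℤₚ.abs-* (+ c) (x - y))

module _ {m : ℕ} where

  ≡-mod-refl : ∀ {x} → x ≡ x [mod m ]
  ≡-mod-refl {x} = subst (m ∣_) (cong ∣_∣ (sym (ℤₚ.+-inverseʳ x))) (m ∣0)

  ≡-mod-sym : ∀ {x y} → x ≡ y [mod m ] → y ≡ x [mod m ]
  ≡-mod-sym {x} {y} = subst (m ∣_) (ℤₚ.∣i-j∣≡∣j-i∣ x y)

  ≡-mod-trans : ∀ {x y z} → x ≡ y [mod m ] → y ≡ z [mod m ] → x ≡ z [mod m ]
  ≡-mod-trans {x} {y} {z} x≡y y≡z =
    Signed.∣⇒∣ᵤ (subst (+ m Signed.∣_) (ℤₚ.+-minus-telescope x y z)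
    (Signed.∣m∣n⇒∣m+n (Signed.∣ᵤ⇒∣ {i = x - y} x≡y) (Signed.∣ᵤ⇒∣ {i = y - z} y≡z)))

  *-congˡ-≡-mod : ∀ (c : ℤ) {x y} → x ≡ y [mod m ] → (c * x) ≡ c * y [mod m ]
  *-congˡ-≡-mod c {x} {y} x≡y = Signed.∣⇒∣ᵤ (subst (+ m Signed.∣_) (*-distribˡ-minus c x y)
    (Signed.∣n⇒∣m*n c (Signed.∣ᵤ⇒∣ x≡y)))

  ≡-mod-setoid : Setoid 0ℓ 0ℓ
  ≡-mod-setoid = record
    { Carrier       = ℤ
    ; _≈_           = _≡_[mod m ]
    ; isEquivalence = record
      { refl  = λ {x} → ≡-mod-refl {x}
      ; sym   = λ {x y} → ≡-mod-sym {x} {y}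
      ; trans = λ {x y z} → ≡-mod-trans {x} {y} {z}
      }
    }

  ∣-respects-≡-mod : ∀ {d x y} → d ∣ m → x ≡ y [mod m ] → d ∣ ∣ y ∣ → d ∣ ∣ x ∣
  ∣-respects-≡-mod {d} {x} {y} d∣m x≡y d∣y = Signed.∣⇒∣ᵤ (Signed.∣m+n∣n⇒∣m {m = x}
    (Signed.∣ᵤ⇒∣ {+ d} {x - y} (∣-trans d∣m x≡y)) (Signed.∣m⇒∣-m (Signed.∣ᵤ⇒∣ {+ d} {y} d∣y)))

module _ {m : ℕ} .{{_ : NonZero m}} where

  module ≡-mod-Reasoning = SetoidReasoning (≡-mod-setoid {m})

  <-≡-mod⇒≡ : ∀ {x y} → x < m → y < m → (+ x) ≡ + y [mod m ] → x ≡ y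
  <-≡-mod⇒≡ {x} {y} x<m y<m x≡y =
    ℤₚ.+-injective (ℤₚ.i-j≡0⇒i≡j (+ x) (+ y) (ℤₚ.∣i∣≡0⇒i≡0 ∣x-y∣≡0))
    where
    ∣x-y∣<m : ∣ + x - + y ∣ < m
    ∣x-y∣<m = subst (_< m) (cong ∣_∣ (sym (ℤₚ.[+m]-[+n]≡m⊖n x y)))
      (ℕₚ.≤-<-trans (ℤₚ.∣m⊝n∣≤m⊔n x y) (ℕₚ.⊔-pres-<m x<m y<m))
    ∣x-y∣≡0 : ∣ + x - + y ∣ ≡ 0
    ∣x-y∣≡0 = trans (sym (m<n⇒m%n≡m ∣x-y∣<m)) (n∣m⇒m%n≡0 _ m x≡y)

  %ℕ-≡-mod : ∀ a → a ≡ + (a %ℕ m) [mod m ]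
  %ℕ-≡-mod a = subst (λ b → b ≡ + (a %ℕ m) [mod m ]) (sym (a≡a%ℕn+[a/ℕn]*n a m))
    (Signed.∣⇒∣ᵤ (Signed.divides (a /ℕ m) (i+j-i≡j (+ (a %ℕ m)) ((a /ℕ m) * + m))))
    where
    i+j-i≡j : ∀ i j → (i ℤ.+ j) - i ≡ j
    i+j-i≡j = solve-∀

  ≡-mod⇒%ℕ≡ : ∀ {x y} → x ≡ y [mod m ] → x %ℕ m ≡ y %ℕ m
  ≡-mod⇒%ℕ≡ {x} {y} x≡y = <-≡-mod⇒≡ (n%ℕd<d x m) (n%ℕd<d y m)
    (begin
      + (x %ℕ m) ≈⟨ %ℕ-≡-mod x ⟨
      x          ≈⟨ x≡y ⟩
      y          ≈⟨ %ℕ-≡-mod y ⟩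
      + (y %ℕ m) ∎)
    where open ≡-mod-Reasoning

  %ℕ≡⇒≡-mod : ∀ {x y} → x %ℕ m ≡ y %ℕ m → x ≡ y [mod m ]
  %ℕ≡⇒≡-mod {x} {y} eq = begin
    x          ≈⟨ %ℕ-≡-mod x ⟩
    + (x %ℕ m) ≡⟨ cong +_ eq ⟩
    + (y %ℕ m) ≈⟨ %ℕ-≡-mod y ⟨
    y          ∎
    where open ≡-mod-Reasoning

unit⇒∤%ℕ : ∀ {p m} .{{_ : NonZero m}} → Prime p → p ∣ m → ((a , _) : U p) → ¬ p ∣ a %ℕ m
unit⇒∤%ℕ {p} {m} isPrime p∣m (a , gcd≡1) p∣a%m = ¬prime[1] (subst Prime p≡1 isPrime)
  where
  coprime : Coprime ∣ a ∣ p
  coprime = gcd≡1⇒coprime (ℤₚ.+-injective gcd≡1)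
  p≡1 : p ≡ 1
  p≡1 = coprime (∣-respects-≡-mod {x = a} {y = + (a %ℕ m)} p∣m (%ℕ-≡-mod a) p∣a%m , ∣-refl)

module MultiplicationByK {k p : ℕ} (2≤k : 2 ≤ k) (isPrime : Prime p) (p∤k : ¬ p ∣ k)
                         (r : ℕ) (k<p^r : k < p ^ r) where

  instance
    p^r≢0 : NonZero (p ^ r)
    p^r≢0 = ℕₚ.m^n≢0 p r {{prime⇒nonZero isPrime}}

  1<p^r : 1 < p ^ r
  1<p^r = ℕₚ.<-trans 2≤k k<p^r

  timesK : ℕ → ℕ
  timesK x = (+ k * + x) %ℕ (p ^ r)

  timesK-injective : ∀ {x y} → x < p ^ r → y < p ^ r → timesK x ≡ timesK y → x ≡ y
  timesK-injective {x} {y} x<p^r y<p^r eq = <-≡-mod⇒≡ x<p^r y<p^r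
    (*-cancelˡ-≡-mod-prime^ isPrime p∤k r {+ x} {+ y} (%ℕ≡⇒≡-mod {x = + k * + x} {y = + k * + y} eq))

  timesK[x]≢x : ∀ {x} → ¬ p ∣ x → timesK x ≢ x
  timesK[x]≢x {x} p∤x eq =
    ℕₚ.<⇒≢ 2≤k (sym (<-≡-mod⇒≡ k<p^r 1<p^r (*-cancelˡ-≡-mod-prime^ isPrime p∤x r xk≡x1)))
    where
    open ≡-mod-Reasoning
    xk≡x1 : (+ x * + k) ≡ + x * + 1 [mod p ^ r ]
    xk≡x1 = begin
      + x * + k   ≡⟨ ℤₚ.*-comm (+ x) (+ k) ⟩
      + k * + x   ≈⟨ %ℕ-≡-mod (+ k * + x) ⟩
      + timesK x ≡⟨ cong +_ eq ⟩
      + x         ≡⟨ ℤₚ.*-identityʳ (+ x) ⟨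
      + x * + 1   ∎

lemma2p4 : (k p : ℕ) → 2 ≤ k → Prime p → ¬ (p ∣ k) →
    (r : ℕ) → IsLeastExp p k r →
    Σ (U p → Fin 3) (λ ψ → (a y : U p) →
      proj₁ y ≡ (+ k) * proj₁ a [mod p ^ r ] → ψ a ≢ ψ y)
lemma2p4 k p 2≤k isPrime p∤k r (k<p^r , _) = ψ , ψ-separates
  where
  open MultiplicationByK 2≤k isPrime p∤k r k<p^r
  open GreedyColouring timesK

  ψ : U p → Fin 3
  ψ (a , _) = colour (a %ℕ (p ^ r))

  ψ-separates : (a y : U p) → proj₁ y ≡ (+ k) * proj₁ a [mod p ^ r ] → ψ a ≢ ψ y
  ψ-separates a′@(a , _) (y , _) y≡ka = subst (λ z → colour x ≢ colour z) (sym y%p^r≡kx)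
    (colour-proper (p ^ r) timesK-injective (n%ℕd<d a (p ^ r)) (n%ℕd<d (+ k * + x) (p ^ r))
      (timesK[x]≢x (unit⇒∤%ℕ isPrime (1<m^n⇒m∣m^n p r 1<p^r) a′)))
    where
    open ≡-mod-Reasoning
    x : ℕ
    x = a %ℕ (p ^ r)
    y%p^r≡kx : y %ℕ (p ^ r) ≡ timesK x
    y%p^r≡kx = ≡-mod⇒%ℕ≡ {x = y} {y = + k * + x} (begin
      y         ≈⟨ y≡ka ⟩
      + k * a   ≈⟨ *-congˡ-≡-mod (+ k) (%ℕ-≡-mod a) ⟩
      + k * + x ∎)
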